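{- If $(G,\sigma)$ is a signed graph, then $\chi((G,\sigma))-1\le\chi_c((G,\sigma))\le\chi((G,\sigma))$.
   Context: Graphs are simple and finite. A signed graph $(G,\sigma)$ is a graph $G$ with a map $\sigma:E(G)\to\{\pm1\}$. For $x\in\mathbb{R}$ and $r>0$, $[x]_r\in[0,r)$ is the remainder of $x$ modulo $r$ and $|x|_r=\min\{[x]_r,[-x]_r\}$. For positive integers $k\ge 2d$, a $(k,d)$-coloring of $(G,\sigma)$ is a map $c:V(G)\to\mathbb{Z}_k$ such that $|c(v)-\sigma(e)c(w)|_k\ge d$ for every edge $e=vw$. The circular chromatic number is $\chi_c((G,\sigma))=\inf\{k/d : (G,\sigma)\text{ has a }(k,d)\text{ -coloring}\}$, and the chromatic number $\chi((G,\sigma))$ is the minimum $k$ such that $(G,\sigma)$ has a $(k,1)$-coloring. -}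

module Defs where

open import Data.Nat using (ℕ; zero; suc; _+_; _*_; _≤_; _<_; _⊓_)
open import Data.Integer as ℤ using (ℤ; +_; _%ℕ_)
open import Data.Fin using (Fin; toℕ)
open import Data.Bool using (Bool; true; false)
open import Data.Sign using (Sign)
open import Data.Product using (Σ; _×_; ∃)
open import Relation.Binary.PropositionalEquality using (_≡_)
open import Relation.Nullary using (¬_)

-- Adjacency is Bool-valued (so there are no multi-edges), symmetric and
-- loopless; the signature assigns a sign to every ordered pair and is
-- symmetric; only its values on edges matter.
record SignedGraph : Set where
  field
    n      : ℕ
    adj    : Fin n → Fin n → Bool
    adj-sym    : ∀ u v → adj u v ≡ adj v u
    adj-irrefl : ∀ v → adj v v ≡ false
    σ      : Fin n → Fin n → Sign
    σ-sym  : ∀ u v → σ u v ≡ σ v u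

_·ˢ_ : Sign → ℤ → ℤ
Sign.+ ·ˢ x = x
Sign.- ·ˢ x = ℤ.- x

-- [x]_k, the remainder of x modulo k (k > 0); value for k = 0 irrelevant
rem : ℕ → ℤ → ℕ
rem zero    x = 0
rem (suc m) x = x %ℕ suc m

∣_∣[_] : ℤ → ℕ → ℕ
∣ x ∣[ k ] = rem k x ⊓ rem k (ℤ.- x)

IsKDColoring : (G : SignedGraph) (k d : ℕ) → (Fin (SignedGraph.n G) → Fin k) → Set
IsKDColoring G k d c =
  1 ≤ d × 2 * d ≤ k ×
  (∀ v w → adj v w ≡ true →
     d ≤ ∣ (+ toℕ (c v)) ℤ.- (σ v w ·ˢ (+ toℕ (c w))) ∣[ k ])
  where open SignedGraph G

HasKDColoring : SignedGraph → ℕ → ℕ → Set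
HasKDColoring G k d = Σ (Fin (SignedGraph.n G) → Fin k) (IsKDColoring G k d)

IsChromaticNumber : SignedGraph → ℕ → Set
IsChromaticNumber G m = HasKDColoring G m 1 × (∀ k → HasKDColoring G k 1 → m ≤ k)

-- Comparisons of a nonnegative rational a/b (b > 0) with
-- χ_c((G,σ)) = inf { k/d : (G,σ) has a (k,d)-coloring }, unfolded:

-- a/b ≤ χ_c : a/b is a lower bound of the set, i.e. a/b ≤ k/d for all
-- (k,d)-colorings (cross-multiplied: a·d ≤ k·b).
RatLeχc : ℕ → ℕ → SignedGraph → Set
RatLeχc a b G = ∀ k d → HasKDColoring G k d → a * d ≤ k * b

-- χ_c ≤ a/b : for every rational ε = p/q > 0 some element k/d of the set
-- satisfies k/d < a/b + p/q (cross-multiplied: k·q·b < (a·q + p·b)·d).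
χcLeRat : SignedGraph → ℕ → ℕ → Set
χcLeRat G a b = ∀ p q → 1 ≤ p → 1 ≤ q →
  Σ ℕ λ k → Σ ℕ λ d → HasKDColoring G k d × k * q * b < (a * q + p * b) * d

-- Given a (k,d)-colouring c and any M > k/d, round M·c(v)/k to the nearest integer and
-- reduce it modulo M.  Rounding moves M·c(v)/k by at most 1/2, so if the new colours of
-- the ends of an edge vw agree up to the sign σ(vw) modulo M, then c(v) − σ(vw)c(w) lies
-- within k/M < d of a multiple of k, contradicting the (k,d)-condition.  Taking
-- M = ⌊k/d⌋ + 1 gives χ ≤ ⌊k/d⌋ + 1, i.e. χ − 1 ≤ k/d.  The upper bound holds because a
-- (χ,1)-colouring is itself one of the colourings in the infimum defining χ_c.
module Submission where

open import Data.Bool using (true)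
open import Data.Fin using (Fin; toℕ; fromℕ<)
open import Data.Fin.Properties using (toℕ-fromℕ<)
open import Data.Integer as ℤ
  using (ℤ; +_; -[1+_]; _+_; _-_; -_; _*_; ∣_∣; _%ℕ_; _/ℕ_; _⊖_; _◃_)
open import Data.Integer.DivMod using (a≡a%ℕn+[a/ℕn]*n; n%ℕd<d)
open import Data.Integer.Divisibility.Signed
  using (_∣_; divides; ∣-refl; ∣m⇒∣-m; ∣m∣n⇒∣m+n; ∣n⇒∣m*n)
import Data.Integer.Properties as ℤP
open import Data.Integer.Tactic.RingSolver using (solve-∀)
open import Data.Nat as ℕ using (ℕ; zero; suc; s≤s; _≤_; _<_; _∸_)
open import Data.Nat.DivMod using (_/_; _%_; m≡m%n+[m/n]*n; m%n<n; m/n*n≤m; m≥n⇒m/n>0)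
import Data.Nat.Properties as ℕP
open import Data.Product using (_×_; ∃-syntax; _,_; proj₁; proj₂)
open import Data.Sign as Sign using (Sign)
open import Data.Sum using (inj₁; inj₂)
open import Relation.Binary.PropositionalEquality

open import Defs

r≤∣r+u*k∣ : ∀ {r k} u → r < suc k →
  + 0 ℤ.≤ + r + u * + suc k → r ≤ ∣ + r + u * + suc k ∣
r≤∣r+u*k∣ {r} {k} (+ n) _ _ = subst (r ≤_) r+nK≡∣w∣ (ℕP.m≤m+n r (n ℕ.* suc k))
  where
  r+nK≡∣w∣ : r ℕ.+ n ℕ.* suc k ≡ ∣ + r + + n * + suc k ∣
  r+nK≡∣w∣ = cong ∣_∣ (trans (ℤP.pos-+ r (n ℕ.* suc k)) (cong (_+_ (+ r)) (ℤP.pos-* n (suc k))))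
-- For u < 0 the integer + r + u * + suc k computes to r ⊖ (1 + …), negative as r < suc k.
r≤∣r+u*k∣ {r} {k} -[1+ n ] r<K 0≤w
  with r ⊖ suc (k ℕ.+ n ℕ.* suc k)
     | ℤP.sign-⊖-< (ℕP.<-≤-trans r<K (ℕP.m≤m+n (suc k) (n ℕ.* suc k))) | 0≤w
... | + _      | () | _
... | -[1+ _ ] | _  | ()

%ℕ-minimal : ∀ k z t → + 0 ℤ.≤ z - t * + suc k → z %ℕ suc k ≤ ∣ z - t * + suc k ∣
%ℕ-minimal k z t 0≤w =
  subst (λ w → z %ℕ suc k ≤ ∣ w ∣) (sym z-tK≡)
    (r≤∣r+u*k∣ (z /ℕ suc k - t) (n%ℕd<d z (suc k)) (subst (+ 0 ℤ.≤_) z-tK≡ 0≤w))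
  where
  regroup : ∀ r q t K → (r + q * K) - t * K ≡ r + (q - t) * K
  regroup = solve-∀
  z-tK≡ : z - t * + suc k ≡ + (z %ℕ suc k) + (z /ℕ suc k - t) * + suc k
  z-tK≡ = trans (cong (_- t * + suc k) (a≡a%ℕn+[a/ℕn]*n z (suc k)))
                (regroup (+ (z %ℕ suc k)) (z /ℕ suc k) t (+ suc k))

∣∣[]≤∣-*∣ : ∀ k z t → ∣ z ∣[ suc k ] ≤ ∣ z - t * + suc k ∣
∣∣[]≤∣-*∣ k z t with ℤP.≤-total (+ 0) (z - t * + suc k)
... | inj₁ 0≤w = ℕP.≤-trans (ℕP.m⊓n≤m _ _) (%ℕ-minimal k z t 0≤w)
... | inj₂ w≤0 = ℕP.≤-trans (ℕP.m⊓n≤n _ _)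
      (subst (λ w → (- z) %ℕ suc k ≤ w) (trans (cong ∣_∣ negate) (ℤP.∣-i∣≡∣i∣ (z - t * + suc k)))
        (%ℕ-minimal k (- z) (- t) (subst (+ 0 ℤ.≤_) (sym negate) (ℤP.neg-mono-≤ w≤0))))
  where
  negate-distrib : ∀ z t K → (- z) - (- t) * K ≡ - (z - t * K)
  negate-distrib = solve-∀
  negate : (- z) - (- t) * + suc k ≡ - (z - t * + suc k)
  negate = negate-distrib z t (+ suc k)

%ℕ≡0⇒∣ : ∀ m w → w %ℕ suc m ≡ 0 → + suc m ∣ w
%ℕ≡0⇒∣ m w r≡0 = divides (w /ℕ suc m)
  (trans (a≡a%ℕn+[a/ℕn]*n w (suc m))
         (trans (cong (λ r → + r + (w /ℕ suc m) * + suc m) r≡0) (ℤP.+-identityˡ _)))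

∣∣[]≡0⇒∣ : ∀ m w → ∣ w ∣[ suc m ] ≡ 0 → + suc m ∣ w
∣∣[]≡0⇒∣ m w ∣w∣≡0 with ℕP.⊓-sel (w %ℕ suc m) ((- w) %ℕ suc m)
... | inj₁ ⊓≡l = %ℕ≡0⇒∣ m w (trans (sym ⊓≡l) ∣w∣≡0)
... | inj₂ ⊓≡r = subst (+ suc m ∣_) (ℤP.neg-involutive w)
                   (∣m⇒∣-m (%ℕ≡0⇒∣ m (- w) (trans (sym ⊓≡r) ∣w∣≡0)))

·ˢ-as-* : ∀ s x → s ·ˢ x ≡ (s ◃ 1) * x
·ˢ-as-* Sign.+ x = sym (ℤP.*-identityˡ x)
·ˢ-as-* Sign.- x = sym (ℤP.-1*i≡-i x)

∣-residues⇒∣ : ∀ m s a b →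
  + suc m ∣ + (a %ℕ suc m) - s ·ˢ (+ (b %ℕ suc m)) → + suc m ∣ a - s ·ˢ b
∣-residues⇒∣ m s a b M∣residues =
  subst (M ∣_) (sym decompose) (∣m∣n⇒∣m+n M∣residues (∣n⇒∣m*n (qa - e * qb) ∣-refl))
  where
  M = + suc m
  e = s ◃ 1
  ra = + (a %ℕ suc m)
  rb = + (b %ℕ suc m)
  qa = a /ℕ suc m
  qb = b /ℕ suc m
  separate : ∀ ra qa rb qb e M →
    (ra + qa * M) - e * (rb + qb * M) ≡ (ra - e * rb) + (qa - e * qb) * M
  separate = solve-∀
  decompose : a - s ·ˢ b ≡ (ra - s ·ˢ rb) + (qa - e * qb) * M
  decompose = begin
    a - s ·ˢ b                          ≡⟨ cong₂ _-_ (a≡a%ℕn+[a/ℕn]*n a (suc m))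
                                             (trans (·ˢ-as-* s b)
                                               (cong (e *_) (a≡a%ℕn+[a/ℕn]*n b (suc m)))) ⟩
    (ra + qa * M) - e * (rb + qb * M)   ≡⟨ separate ra qa rb qb e M ⟩
    (ra - e * rb) + (qa - e * qb) * M   ≡⟨ cong (λ t → ra - t + (qa - e * qb) * M) (·ˢ-as-* s rb) ⟨
    (ra - s ·ˢ rb) + (qa - e * qb) * M  ∎
    where open ≡-Reasoning

∣m-n∣≤m : ∀ m n → n < 2 ℕ.* m → ∣ + m - + n ∣ ≤ m
∣m-n∣≤m m n n<2m with ℕP.≤-total n m
... | inj₁ n≤m = subst (_≤ m) (sym (cong ∣_∣ (trans (ℤP.m-n≡m⊖n m n) (ℤP.⊖-≥ n≤m))))
                   (ℕP.m∸n≤m m n)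
... | inj₂ m≤n = subst (_≤ m) (sym (trans (cong ∣_∣ (ℤP.m-n≡m⊖n m n)) (ℤP.∣⊖∣-≤ m≤n)))
                   (ℕP.m≤n+o⇒m∸n≤o n m
                     (ℕP.<⇒≤ (subst (n <_) (cong (m ℕ.+_) (ℕP.+-identityʳ m)) n<2m)))

nearest-multiple : ∀ k X → ∃[ a ] 2 ℕ.* ∣ a * + suc k - X ∣ ≤ suc k
nearest-multiple k X =
  a , subst (_≤ suc k) (sym 2∣aK-X∣≡∣K-r∣) (∣m-n∣≤m (suc k) r (n%ℕd<d Y (2 ℕ.* suc k)))
  where
  K = + suc k
  Y = + 2 * X + K
  r = Y %ℕ (2 ℕ.* suc k)
  a = Y /ℕ (2 ℕ.* suc k)
  Y≡r+a2K : Y ≡ + r + a * (+ 2 * K)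
  Y≡r+a2K = trans (a≡a%ℕn+[a/ℕn]*n Y (2 ℕ.* suc k)) (cong (λ t → + r + a * t) (ℤP.pos-* 2 (suc k)))
  expand : ∀ a K X → + 2 * (a * K - X) ≡ a * (+ 2 * K) - (+ 2 * X + K) + K
  expand = solve-∀
  cancel : ∀ a K r → a * (+ 2 * K) - (r + a * (+ 2 * K)) + K ≡ K - r
  cancel = solve-∀
  2[aK-X]≡K-r : + 2 * (a * K - X) ≡ K - + r
  2[aK-X]≡K-r = begin
    + 2 * (a * K - X)                           ≡⟨ expand a K X ⟩
    a * (+ 2 * K) - Y + K                       ≡⟨ cong (λ t → a * (+ 2 * K) - t + K) Y≡r+a2K ⟩
    a * (+ 2 * K) - (+ r + a * (+ 2 * K)) + K   ≡⟨ cancel a K (+ r) ⟩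
    K - + r                                     ∎
    where open ≡-Reasoning
  2∣aK-X∣≡∣K-r∣ : 2 ℕ.* ∣ a * K - X ∣ ≡ ∣ K - + r ∣
  2∣aK-X∣≡∣K-r∣ = trans (sym (ℤP.∣i*j∣≡∣i∣*∣j∣ (+ 2) (a * K - X))) (cong ∣_∣ 2[aK-X]≡K-r)

-- |a − M·x/k| ≤ 1/2, i.e. a is a nearest integer to M·x/k.
record RoundsTo (M k : ℕ) (x a : ℤ) : Set where
  constructor rounds
  field 2∣error∣≤k : 2 ℕ.* ∣ a * + k - + M * x ∣ ≤ k

rounding-exists : ∀ M k x → ∃[ a ] RoundsTo M (suc k) x a
rounding-exists M k x = let a , bound = nearest-multiple k (+ M * x) in a , rounds bound

roundsTo-·ˢ : ∀ s {M k x a} → RoundsTo M k x a → RoundsTo M k (s ·ˢ x) (s ·ˢ a)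
roundsTo-·ˢ Sign.+ ρ = ρ
roundsTo-·ˢ Sign.- {M} {k} {x} {a} (rounds bound) =
  rounds (subst (λ n → 2 ℕ.* n ≤ k) (sym ∣error∣) bound)
  where
  negate : ∀ a k M x → (- a) * k - M * (- x) ≡ - (a * k - M * x)
  negate = solve-∀
  ∣error∣ : ∣ (- a) * + k - + M * (- x) ∣ ≡ ∣ a * + k - + M * x ∣
  ∣error∣ = trans (cong ∣_∣ (negate a (+ k) (+ M) x)) (ℤP.∣-i∣≡∣i∣ (a * + k - + M * x))

roundings-close : ∀ {M k d x y a b} → k < M ℕ.* d →
  RoundsTo M k x a → RoundsTo M k y b → + M ∣ a - b → ∃[ c ] ∣ x - y - c * + k ∣ < d
roundings-close {M} {k} {d} {x} {y} {a} {b} k<Md (rounds ρx) (rounds ρy) (divides c a-b≡cM) =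
  c , ℕP.*-cancelˡ-< M ∣ e ∣ d (ℕP.≤-<-trans M∣e∣≤k k<Md)
  where
  e = x - y - c * + k
  εx = a * + k - + M * x
  εy = b * + k - + M * y
  expand : ∀ M k x y a b → (b * k - M * y) - (a * k - M * x) ≡ M * x - M * y - (a - b) * k
  expand = solve-∀
  collect : ∀ M k x y c → M * x - M * y - c * M * k ≡ M * (x - y - c * k)
  collect = solve-∀
  εy-εx≡Me : εy - εx ≡ + M * e
  εy-εx≡Me = begin
    εy - εx                               ≡⟨ expand (+ M) (+ k) x y a b ⟩
    + M * x - + M * y - (a - b) * + k     ≡⟨ cong (λ t → + M * x - + M * y - t * + k) a-b≡cM ⟩
    + M * x - + M * y - c * + M * + k     ≡⟨ collect (+ M) (+ k) x y c ⟩
    + M * e                               ∎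
    where open ≡-Reasoning
  2M∣e∣≤2k : 2 ℕ.* (M ℕ.* ∣ e ∣) ≤ 2 ℕ.* k
  2M∣e∣≤2k = begin
    2 ℕ.* (M ℕ.* ∣ e ∣)             ≡⟨ cong (2 ℕ.*_) (trans (sym (ℤP.∣i*j∣≡∣i∣*∣j∣ (+ M) e))
                                                             (cong ∣_∣ (sym εy-εx≡Me))) ⟩
    2 ℕ.* ∣ εy - εx ∣               ≤⟨ ℕP.*-monoʳ-≤ 2 (ℤP.∣i-j∣≤∣i∣+∣j∣ εy εx) ⟩
    2 ℕ.* (∣ εy ∣ ℕ.+ ∣ εx ∣)       ≡⟨ ℕP.*-distribˡ-+ 2 ∣ εy ∣ ∣ εx ∣ ⟩
    2 ℕ.* ∣ εy ∣ ℕ.+ 2 ℕ.* ∣ εx ∣   ≤⟨ ℕP.+-mono-≤ ρy ρx ⟩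
    k ℕ.+ k                         ≡⟨ cong (k ℕ.+_) (ℕP.+-identityʳ k) ⟨
    2 ℕ.* k                         ∎
    where open ℕP.≤-Reasoning
  M∣e∣≤k : M ℕ.* ∣ e ∣ ≤ k
  M∣e∣≤k = ℕP.*-cancelˡ-≤ 2 2M∣e∣≤2k

rounded-residues-separated : ∀ {k m d} → suc k < suc m ℕ.* d → ∀ s {x y a b} →
  RoundsTo (suc m) (suc k) x a → RoundsTo (suc m) (suc k) y b → d ≤ ∣ x - s ·ˢ y ∣[ suc k ] →
  1 ≤ ∣ + (a %ℕ suc m) - s ·ˢ (+ (b %ℕ suc m)) ∣[ suc m ]
rounded-residues-separated {k} {m} K<Md s {x} {y} {a} {b} ρx ρy separated = ℕP.n≢0⇒n>0 λ ∣∣≡0 →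
  let c , close = roundings-close K<Md ρx (roundsTo-·ˢ s ρy)
                    (∣-residues⇒∣ m s a b (∣∣[]≡0⇒∣ m _ ∣∣≡0))
  in ℕP.<⇒≱ (ℕP.≤-<-trans (∣∣[]≤∣-*∣ k (x - s ·ˢ y) c) close) separated

round-coloring : ∀ G {k m d} → suc k < suc m ℕ.* d → 1 ≤ m →
  HasKDColoring G (suc k) d → HasKDColoring G (suc m) 1
round-coloring G {k} {m} K<Md 1≤m (c , _ , _ , proper) = c′ , ℕP.≤-refl , s≤s 1≤m , proper′
  where
  open SignedGraph G
  rounding : ∀ v → ∃[ a ] RoundsTo (suc m) (suc k) (+ toℕ (c v)) a
  rounding v = rounding-exists (suc m) k (+ toℕ (c v))
  residue<M : ∀ v → proj₁ (rounding v) %ℕ suc m < suc m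
  residue<M v = n%ℕd<d (proj₁ (rounding v)) (suc m)
  c′ : Fin n → Fin (suc m)
  c′ v = fromℕ< (residue<M v)
  proper′ : ∀ v w → adj v w ≡ true → 1 ≤ ∣ + toℕ (c′ v) - σ v w ·ˢ (+ toℕ (c′ w)) ∣[ suc m ]
  proper′ v w vw rewrite toℕ-fromℕ< (residue<M v) | toℕ-fromℕ< (residue<M w) =
    rounded-residues-separated K<Md (σ v w) (proj₂ (rounding v)) (proj₂ (rounding w))
      (proper v w vw)

m<[1+m/n]*n : ∀ m n .{{_ : ℕ.NonZero n}} → m < suc (m / n) ℕ.* n
m<[1+m/n]*n m n = begin-strict
  m                   ≡⟨ m≡m%n+[m/n]*n m n ⟩
  m % n ℕ.+ m / n ℕ.* n <⟨ ℕP.+-monoˡ-< (m / n ℕ.* n) (m%n<n m n) ⟩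
  n ℕ.+ m / n ℕ.* n   ∎
  where open ℕP.≤-Reasoning

χ∸1≤χc : ∀ G {χ} → (∀ k → HasKDColoring G k 1 → χ ≤ k) → RatLeχc (χ ∸ 1) 1 G
χ∸1≤χc G {χ} χ-minimal k zero (_ , () , _)
χ∸1≤χc G {χ} χ-minimal zero (suc d) (_ , _ , () , _)
χ∸1≤χc G {χ} χ-minimal (suc k) (suc d) coloring@(_ , _ , 2d≤k , _) = begin
  (χ ∸ 1) ℕ.* suc d         ≤⟨ ℕP.*-monoˡ-≤ (suc d) (ℕP.∸-monoˡ-≤ 1 χ≤1+k/d) ⟩
  (suc k / suc d) ℕ.* suc d ≤⟨ m/n*n≤m (suc k) (suc d) ⟩
  suc k                     ≡⟨ ℕP.*-identityʳ (suc k) ⟨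
  suc k ℕ.* 1               ∎
  where
  open ℕP.≤-Reasoning
  d≤k : suc d ≤ suc k
  d≤k = ℕP.≤-trans (ℕP.m≤m+n (suc d) (suc d ℕ.+ 0)) 2d≤k
  χ≤1+k/d : χ ≤ suc (suc k / suc d)
  χ≤1+k/d = χ-minimal _ (round-coloring G (m<[1+m/n]*n (suc k) (suc d)) (m≥n⇒m/n>0 d≤k) coloring)

χc≤k/d : ∀ G {k d} → HasKDColoring G k d → χcLeRat G k d
χc≤k/d G {k} {d} coloring@(_ , 1≤d , _) p q 1≤p _ = k , d , coloring , (begin-strict
  k ℕ.* q ℕ.* d                      <⟨ ℕP.m<m+n (k ℕ.* q ℕ.* d)
                                            (ℕP.*-mono-≤ (ℕP.*-mono-≤ 1≤p 1≤d) 1≤d) ⟩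
  k ℕ.* q ℕ.* d ℕ.+ p ℕ.* d ℕ.* d    ≡⟨ ℕP.*-distribʳ-+ d (k ℕ.* q) (p ℕ.* d) ⟨
  (k ℕ.* q ℕ.+ p ℕ.* d) ℕ.* d        ∎)
  where open ℕP.≤-Reasoning

theorem14 : (G : SignedGraph) (χ : ℕ) → IsChromaticNumber G χ →
    RatLeχc (χ ∸ 1) 1 G × χcLeRat G χ 1
theorem14 G χ (χ-colorable , χ-minimal) = χ∸1≤χc G χ-minimal , χc≤k/d G χ-colorable
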